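{- Let $n\ge 1$ and let $a_1,\dots,a_n$ be positive integers forming a symmetric sequence, i.e. $a_i=a_{n+1-i}$ for $1\le i\le n$. Define integers $P_i,Q_i$ ($-1\le i\le n$) by $P_{ -1}=1$, $Q_{ -1}=0$, $P_0=0$, $Q_0=1$ and, for $1\le i\le n$, $P_i=a_iP_{i-1}+P_{i-2}$, $Q_i=a_iQ_{i-1}+Q_{i-2}$ (so $P_i/Q_i$ is the $i$-th approximant of the continued fraction $0+\frac{1}{a_1+}\frac{1}{a_2+}\cdots\frac{1}{a_n}$). Then there exists a positive integer $a_0$ such that $\dfrac{2a_0P_n+P_{n-1}}{Q_n}$ is an integer if and only if $P_{n-1}Q_{n-1}$ is even. -}

module Defs where

open import Data.Nat using (ℕ; zero; suc; _+_; _*_)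

-- Continued-fraction numerators/denominators, shifted by one index:
-- Pₛ a k = P_{k-1}, Qₛ a k = Q_{k-1}, where a i is a_i (i ≥ 1).
Pₛ : (ℕ → ℕ) → ℕ → ℕ
Pₛ a zero = 1
Pₛ a (suc zero) = 0
Pₛ a (suc (suc k)) = a (suc k) * Pₛ a (suc k) + Pₛ a k

Qₛ : (ℕ → ℕ) → ℕ → ℕ
Qₛ a zero = 0
Qₛ a (suc zero) = 1
Qₛ a (suc (suc k)) = a (suc k) * Qₛ a (suc k) + Qₛ a k

P : (ℕ → ℕ) → ℕ → ℕ
P a i = Pₛ a (suc i)

Q : (ℕ → ℕ) → ℕ → ℕ
Q a i = Qₛ a (suc i)

{-# OPTIONS --safe #-}
-- P_n and Q_n are continuants of a₂…aₙ and a₁…aₙ, and a continuant does not change when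
-- its arguments are reversed; for a symmetric sequence this gives Q_{n-1} = P_n. The
-- determinant identity |Q_n P_{n-1} − P_n Q_{n-1}| = 1 then reads Q_n P_{n-1} = P_n² ± 1, so
-- P_n is a unit modulo Q_n with P_n² ≡ ∓1. If P_{n-1} and P_n are both odd this forces Q_n to
-- be even, and Q_n cannot divide the odd number 2a₀P_n + P_{n-1}. Conversely, if
-- P_{n-1}P_n = 2m, then P_n (2a₀P_n + P_{n-1}) ≡ 2(m ∓ a₀) modulo Q_n, which vanishes for
-- a₀ ≡ ±m.
module Submission where

open import Defs
open import Data.Nat using (ℕ; zero; suc; _+_; _*_; _∸_; _≤_; _<_; ∣_-_∣; z≤n; s≤s)
open import Data.Nat.Properties
open import Data.Nat.Divisibility
open import Data.Nat.Coprimality using (Coprime; coprime-divisor)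
open import Data.Nat.Primality using (euclidsLemma; prime[2])
open import Data.Nat.Tactic.RingSolver using (solve; solve-∀)
open import Data.List.Base using (List; []; _∷_; _∷ʳ_; reverse; applyUpTo; applyDownFrom)
open import Data.List.Properties using (applyUpTo-∷ʳ; unfold-reverse; reverse-applyUpTo)
open import Data.Product using (Σ; _×_; _,_)
open import Data.Sum as Sum using (_⊎_; inj₁; inj₂; [_,_]′)
open import Data.Empty using (⊥-elim)
open import Function using (_∘_; id)
open import Function.Bundles using (_⇔_; mk⇔)
open import Relation.Nullary using (¬_; yes; no; contradiction)
open import Relation.Binary.PropositionalEquality
open ≡-Reasoning

continuant : List ℕ → ℕ
continuant []           = 1
continuant (x ∷ [])     = x
continuant (x ∷ y ∷ xs) = x * continuant (y ∷ xs) + continuant xs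

continuant-∷ʳ : ∀ xs y z → continuant (xs ∷ʳ y ∷ʳ z) ≡ z * continuant (xs ∷ʳ y) + continuant xs
continuant-∷ʳ []           y z = cong (_+ 1) (*-comm y z)
continuant-∷ʳ (x ∷ [])     y z = identity x y z
  where identity : ∀ x y z → x * (y * z + 1) + z ≡ z * (x * y + 1) + x
        identity = solve-∀
continuant-∷ʳ (x ∷ x′ ∷ xs) y z = begin
  x * continuant (x′ ∷ xs ∷ʳ y ∷ʳ z) + continuant (xs ∷ʳ y ∷ʳ z)
    ≡⟨ cong₂ (λ u v → x * u + v) (continuant-∷ʳ (x′ ∷ xs) y z) (continuant-∷ʳ xs y z) ⟩
  x * (z * continuant (x′ ∷ xs ∷ʳ y) + continuant (x′ ∷ xs)) + (z * continuant (xs ∷ʳ y) + continuant xs)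
    ≡⟨ regroup x z _ _ _ _ ⟩
  z * continuant (x ∷ x′ ∷ xs ∷ʳ y) + continuant (x ∷ x′ ∷ xs) ∎
  where regroup : ∀ x z u v w t → x * (z * u + v) + (z * w + t) ≡ z * (x * u + w) + (x * v + t)
        regroup = solve-∀

continuant-reverse : ∀ xs → continuant (reverse xs) ≡ continuant xs
continuant-reverse []              = refl
continuant-reverse (x ∷ [])        = refl
continuant-reverse (x ∷ yzs@(y ∷ zs)) = begin
  continuant (reverse (x ∷ y ∷ zs))
    ≡⟨ cong continuant reverse-cons-cons ⟩
  continuant (reverse zs ∷ʳ y ∷ʳ x)
    ≡⟨ continuant-∷ʳ (reverse zs) y x ⟩
  x * continuant (reverse zs ∷ʳ y) + continuant (reverse zs)
    ≡⟨ cong (λ ys → x * continuant ys + continuant (reverse zs)) (unfold-reverse y zs) ⟨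
  x * continuant (reverse yzs) + continuant (reverse zs)
    ≡⟨ cong₂ (λ u v → x * u + v) (continuant-reverse yzs) (continuant-reverse zs) ⟩
  continuant (x ∷ y ∷ zs) ∎
  where reverse-cons-cons : reverse (x ∷ y ∷ zs) ≡ reverse zs ∷ʳ y ∷ʳ x
        reverse-cons-cons = trans (unfold-reverse x yzs) (cong (_∷ʳ x) (unfold-reverse y zs))

applyDownFrom-mirror : ∀ (f g : ℕ → ℕ) n → (∀ i j → suc (j + i) ≡ n → f i ≡ g j) →
                       applyDownFrom f n ≡ applyUpTo g n
applyDownFrom-mirror f g zero    _      = refl
applyDownFrom-mirror f g (suc n) mirror =
  cong₂ _∷_ (mirror n 0 refl) (applyDownFrom-mirror f (g ∘ suc) n (λ i j e → mirror i (suc j) (cong suc e)))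

continuant-applyUpTo : ∀ f k → continuant (applyUpTo f (suc (suc k))) ≡
                       f (suc k) * continuant (applyUpTo f (suc k)) + continuant (applyUpTo f k)
continuant-applyUpTo f k = begin
  continuant (applyUpTo f (suc (suc k)))
    ≡⟨ cong continuant two-snocs ⟨
  continuant (applyUpTo f k ∷ʳ f k ∷ʳ f (suc k))
    ≡⟨ continuant-∷ʳ (applyUpTo f k) (f k) (f (suc k)) ⟩
  f (suc k) * continuant (applyUpTo f k ∷ʳ f k) + continuant (applyUpTo f k)
    ≡⟨ cong (λ xs → f (suc k) * continuant xs + continuant (applyUpTo f k)) (applyUpTo-∷ʳ f k) ⟩
  f (suc k) * continuant (applyUpTo f (suc k)) + continuant (applyUpTo f k) ∎
  where two-snocs : applyUpTo f k ∷ʳ f k ∷ʳ f (suc k) ≡ applyUpTo f (suc (suc k))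
        two-snocs = trans (cong (_∷ʳ f (suc k)) (applyUpTo-∷ʳ f k)) (applyUpTo-∷ʳ f (suc k))

Q≡continuant : ∀ a k → Q a k ≡ continuant (applyUpTo (a ∘ suc) k)
Q≡continuant a zero          = refl
Q≡continuant a (suc zero)    = trans (+-identityʳ _) (*-identityʳ _)
Q≡continuant a (suc (suc k)) = begin
  a (suc (suc k)) * Q a (suc k) + Q a k
    ≡⟨ cong₂ (λ u v → a (suc (suc k)) * u + v) (Q≡continuant a (suc k)) (Q≡continuant a k) ⟩
  a (suc (suc k)) * continuant (applyUpTo (a ∘ suc) (suc k)) + continuant (applyUpTo (a ∘ suc) k)
    ≡⟨ continuant-applyUpTo (a ∘ suc) k ⟨
  continuant (applyUpTo (a ∘ suc) (suc (suc k))) ∎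

Pₛ≡Qₛ-tail : ∀ a k → Pₛ a (suc k) ≡ Qₛ (a ∘ suc) k
Pₛ≡Qₛ-tail a zero          = refl
Pₛ≡Qₛ-tail a (suc zero)    = cong (_+ 1) (*-zeroʳ (a 1))
Pₛ≡Qₛ-tail a (suc (suc k)) =
  cong₂ (λ u v → a (suc (suc k)) * u + v) (Pₛ≡Qₛ-tail a (suc k)) (Pₛ≡Qₛ-tail a k)

palindrome⇒Q≡P : ∀ m a → (∀ i → 1 ≤ i → i ≤ suc m → a i ≡ a (suc (suc m) ∸ i)) →
                  Q a m ≡ P a (suc m)
palindrome⇒Q≡P m a palindrome = begin
  Q a m                                                ≡⟨ Q≡continuant a m ⟩
  continuant (applyUpTo (a ∘ suc) m)                   ≡⟨ continuant-reverse (applyUpTo (a ∘ suc) m) ⟨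
  continuant (reverse (applyUpTo (a ∘ suc) m))         ≡⟨ cong continuant (reverse-applyUpTo _ m) ⟩
  continuant (applyDownFrom (a ∘ suc) m)               ≡⟨ cong continuant (applyDownFrom-mirror _ _ m mirror) ⟩
  continuant (applyUpTo (a ∘ suc ∘ suc) m)             ≡⟨ Q≡continuant (a ∘ suc) m ⟨
  Q (a ∘ suc) m                                        ≡⟨ Pₛ≡Qₛ-tail a (suc m) ⟨
  P a (suc m)                                          ∎
  where
  mirror : ∀ i j → suc (j + i) ≡ m → a (suc i) ≡ a (suc (suc j))
  mirror i j refl = trans (palindrome (suc i) (s≤s z≤n) (s≤s (m≤n+m i (suc j))))
                          (cong a (m+n∸n≡m (suc (suc j)) i))

∣det∣-step : ∀ c q q′ p p′ → ∣ q * p′ - p * q′ ∣ ≡ 1 →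
             ∣ (c * q + q′) * p - (c * p + p′) * q ∣ ≡ 1
∣det∣-step c q q′ p p′ det = begin
  ∣ (c * q + q′) * p - (c * p + p′) * q ∣     ≡⟨ cong₂ ∣_-_∣ (expandˡ c q q′ p) (expandʳ c q p p′) ⟩
  ∣ c * q * p + p * q′ - c * q * p + q * p′ ∣ ≡⟨ ∣m+n-m+o∣≡∣n-o∣ (c * q * p) (p * q′) (q * p′) ⟩
  ∣ p * q′ - q * p′ ∣                         ≡⟨ ∣-∣-comm (p * q′) (q * p′) ⟩
  ∣ q * p′ - p * q′ ∣                         ≡⟨ det ⟩
  1                                           ∎
  where expandˡ : ∀ c q q′ p → (c * q + q′) * p ≡ c * q * p + p * q′
        expandˡ = solve-∀
        expandʳ : ∀ c q p p′ → (c * p + p′) * q ≡ c * q * p + q * p′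
        expandʳ = solve-∀

determinant : ∀ a k → ∣ Qₛ a (suc k) * Pₛ a k - Pₛ a (suc k) * Qₛ a k ∣ ≡ 1
determinant a zero    = refl
determinant a (suc k) = ∣det∣-step (a (suc k)) _ _ _ _ (determinant a k)

Q-positive : ∀ n a → (∀ i → 1 ≤ i → i ≤ n → 0 < a i) → ∀ k → k ≤ n → 0 < Q a k
Q-positive n a positive zero    _   = s≤s z≤n
Q-positive n a positive (suc k) k<n =
  ≤-trans (*-mono-≤ (positive (suc k) (s≤s z≤n) k<n) (Q-positive n a positive k (<⇒≤ k<n)))
          (m≤m+n _ _)

∣m-n∣≡1⇒m≡1+n⊎n≡1+m : ∀ m n → ∣ m - n ∣ ≡ 1 → m ≡ suc n ⊎ n ≡ suc m
∣m-n∣≡1⇒m≡1+n⊎n≡1+m zero    n       eq = inj₂ eq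
∣m-n∣≡1⇒m≡1+n⊎n≡1+m (suc m) zero    eq = inj₁ eq
∣m-n∣≡1⇒m≡1+n⊎n≡1+m (suc m) (suc n) eq = Sum.map (cong suc) (cong suc) (∣m-n∣≡1⇒m≡1+n⊎n≡1+m m n eq)

2∣n⊎2∣1+n : ∀ n → 2 ∣ n ⊎ 2 ∣ suc n
2∣n⊎2∣1+n zero    = inj₁ (2 ∣0)
2∣n⊎2∣1+n (suc n) = [ inj₂ ∘ ∣m∣n⇒∣m+n (n∣n {2}) , inj₁ ]′ (2∣n⊎2∣1+n n)

∣m-n∣≡1⇒2∣m⊎2∣n : ∀ m n → ∣ m - n ∣ ≡ 1 → 2 ∣ m ⊎ 2 ∣ n
∣m-n∣≡1⇒2∣m⊎2∣n m n eq with ∣m-n∣≡1⇒m≡1+n⊎n≡1+m m n eq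
... | inj₁ refl = Sum.swap (2∣n⊎2∣1+n n)
... | inj₂ refl = 2∣n⊎2∣1+n m

∣n∣1+n⇒≡1 : ∀ {d} n → d ∣ n → d ∣ suc n → d ≡ 1
∣n∣1+n⇒≡1 {d} n d∣n d∣1+n = ∣1⇒≡1 (∣m+n∣m⇒∣n (subst (d ∣_) (+-comm 1 n) d∣1+n) d∣n)

∣qr-ps∣≡1⇒coprime : ∀ q r p s → ∣ q * r - p * s ∣ ≡ 1 → Coprime q p
∣qr-ps∣≡1⇒coprime q r p s det {d} (d∣q , d∣p) with ∣m-n∣≡1⇒m≡1+n⊎n≡1+m (q * r) (p * s) det
... | inj₁ qr≡1+ps = ∣n∣1+n⇒≡1 (p * s) (∣m⇒∣m*n s d∣p) (subst (d ∣_) qr≡1+ps (∣m⇒∣m*n r d∣q))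
... | inj₂ ps≡1+qr = ∣n∣1+n⇒≡1 (q * r) (∣m⇒∣m*n r d∣q) (subst (d ∣_) ps≡1+qr (∣m⇒∣m*n s d∣p))

Solvable : ℕ → ℕ → ℕ → Set
Solvable q p r = Σ ℕ λ a₀ → 0 < a₀ × q ∣ 2 * a₀ * p + r

2∤r⇒2∤p⇒2∣q : ∀ q r p → ∣ q * r - p * p ∣ ≡ 1 → ¬ 2 ∣ r → ¬ 2 ∣ p → 2 ∣ q
2∤r⇒2∤p⇒2∣q q r p det 2∤r 2∤p with ∣m-n∣≡1⇒2∣m⊎2∣n (q * r) (p * p) det
... | inj₁ 2∣qr = [ id , (λ 2∣r → contradiction 2∣r 2∤r) ]′ (euclidsLemma q r prime[2] 2∣qr)
... | inj₂ 2∣pp = ⊥-elim ([ 2∤p , 2∤p ]′ (euclidsLemma p p prime[2] 2∣pp))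

solvable⇒even : ∀ q r p → ∣ q * r - p * p ∣ ≡ 1 → Solvable q p r → 2 ∣ r * p
solvable⇒even q r p det (a₀ , _ , q∣2a₀p+r) with 2 ∣? r | 2 ∣? p
... | yes 2∣r | _       = ∣m⇒∣m*n p 2∣r
... | no _    | yes 2∣p = ∣n⇒∣m*n r 2∣p
... | no 2∤r  | no 2∤p  = contradiction 2∣r 2∤r
  where 2∣r : 2 ∣ r
        2∣r = ∣m+n∣m⇒∣n (∣-trans (2∤r⇒2∤p⇒2∣q q r p det 2∤r 2∤p) q∣2a₀p+r) (∣m⇒∣m*n p (m∣m*n a₀))

solvable-if-qr≡1+p² : ∀ q r p m → 0 < q → Coprime q p → q * r ≡ suc (p * p) → r * p ≡ m * 2 →
                      Solvable q p r
solvable-if-qr≡1+p² q r p m q>0 coprime qr≡1+pp rp≡2m =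
  m + q , ≤-trans q>0 (m≤n+m q m) ,
  coprime-divisor coprime (∣m+n∣m⇒∣n (divides (2 * (m + q) * r) identity) (m∣m*n 2))
  where
  identity : q * 2 + p * (2 * (m + q) * p + r) ≡ 2 * (m + q) * r * q
  identity = begin
    q * 2 + p * (2 * (m + q) * p + r)       ≡⟨ solve (m ∷ q ∷ p ∷ r ∷ []) ⟩
    q * 2 + 2 * (m + q) * (p * p) + r * p   ≡⟨ cong (q * 2 + 2 * (m + q) * (p * p) +_) rp≡2m ⟩
    q * 2 + 2 * (m + q) * (p * p) + m * 2   ≡⟨ solve (m ∷ q ∷ p ∷ []) ⟩
    2 * (m + q) * (1 + p * p)               ≡⟨ cong (2 * (m + q) *_) qr≡1+pp ⟨
    2 * (m + q) * (q * r)                   ≡⟨ solve (m ∷ q ∷ r ∷ []) ⟩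
    2 * (m + q) * r * q                     ∎

solvable-if-p²≡1+qr : ∀ q r p m → 0 < q → Coprime q p → p * p ≡ suc (q * r) → r * p ≡ m * 2 →
                      Solvable q p r
-- the witness q′ m + q equals q (m + 1) − m, hence is ≡ −m modulo q
solvable-if-p²≡1+qr (suc q′) r p m _ coprime pp≡1+qr rp≡2m =
  q′ * m + suc q′ , ≤-trans (s≤s z≤n) (m≤n+m (suc q′) (q′ * m)) ,
  coprime-divisor coprime (divides (2 * (q′ * m + suc q′) * r + 2 * (m + 1)) identity)
  where
  identity : p * (2 * (q′ * m + suc q′) * p + r) ≡ (2 * (q′ * m + suc q′) * r + 2 * (m + 1)) * suc q′
  identity = begin
    p * (2 * (q′ * m + suc q′) * p + r)                 ≡⟨ solve (q′ ∷ m ∷ p ∷ r ∷ []) ⟩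
    2 * (q′ * m + suc q′) * (p * p) + r * p
      ≡⟨ cong₂ (λ s t → 2 * (q′ * m + suc q′) * s + t) pp≡1+qr rp≡2m ⟩
    2 * (q′ * m + suc q′) * (1 + suc q′ * r) + m * 2    ≡⟨ solve (q′ ∷ m ∷ r ∷ []) ⟩
    (2 * (q′ * m + suc q′) * r + 2 * (m + 1)) * suc q′  ∎

even⇒solvable : ∀ q r p → 0 < q → ∣ q * r - p * p ∣ ≡ 1 → 2 ∣ r * p → Solvable q p r
even⇒solvable q r p q>0 det (divides m rp≡2m) with ∣m-n∣≡1⇒m≡1+n⊎n≡1+m (q * r) (p * p) det
... | inj₁ qr≡1+pp = solvable-if-qr≡1+p² q r p m q>0 (∣qr-ps∣≡1⇒coprime q r p p det) qr≡1+pp rp≡2m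
... | inj₂ pp≡1+qr = solvable-if-p²≡1+qr q r p m q>0 (∣qr-ps∣≡1⇒coprime q r p p det) pp≡1+qr rp≡2m

theorem1 : (n : ℕ) → 1 ≤ n → (a : ℕ → ℕ)
    → (∀ i → 1 ≤ i → i ≤ n → 0 < a i)
    → (∀ i → 1 ≤ i → i ≤ n → a i ≡ a (suc n ∸ i))
    → (Σ ℕ (λ a₀ → 0 < a₀ × Q a n ∣ 2 * a₀ * P a n + P a (n ∸ 1)))
      ⇔ (2 ∣ P a (n ∸ 1) * Q a (n ∸ 1))
theorem1 zero    ()
theorem1 (suc m) _  a positive palindrome =
  subst (λ t → Solvable (Q a (suc m)) (P a (suc m)) (P a m) ⇔ (2 ∣ P a m * t)) (sym Q≡P)
    (mk⇔ (solvable⇒even _ _ _ det) (even⇒solvable _ _ _ Q>0 det))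
  where
  Q≡P : Q a m ≡ P a (suc m)
  Q≡P = palindrome⇒Q≡P m a palindrome
  det : ∣ Q a (suc m) * P a m - P a (suc m) * P a (suc m) ∣ ≡ 1
  det = subst (λ t → ∣ Q a (suc m) * P a m - P a (suc m) * t ∣ ≡ 1) Q≡P (determinant a (suc m))
  Q>0 : 0 < Q a (suc m)
  Q>0 = Q-positive (suc m) a positive (suc m) ≤-refl
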